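{- Let $G$ be an odd cactus, let $a,b\in V(G)$, and let $P$ be an $a,b$ path in $G$. Let $C$ be a cycle contained in $G$ and let $e\in E(C)$. If $e\in E(P)$ and $\mathrm{opp}(e)\in V(P)$, then $P$ is not a shortest $a,b$ path.
   Context: All graphs are finite, simple, connected and non-empty. A cactus is a graph in which every edge lies in at most one cycle; an odd cactus has no even cycle. For an odd cycle $C$ and an edge $v_2v_3\in E(C)$, $\mathrm{opp}(v_2v_3)$ denotes the unique vertex $v_1\in V(C)$ with $d(v_1,v_2)=d(v_1,v_3)$. -}

module Defs where

open import Data.Nat using (ℕ; zero; suc; _+_; _*_; _≤_; _<_)
open import Data.Bool using (Bool; true)
open import Data.Fin using (Fin)
open import Data.List using (List; []; _∷_; _++_; [_]; length; head; last)
open import Data.List.Relation.Unary.Linked using (Linked)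
open import Data.List.Relation.Unary.Unique.Propositional using (Unique)
open import Data.List.Membership.Propositional using (_∈_)
open import Data.Maybe using (just)
open import Data.Product using (Σ; ∃; _×_; _,_)
open import Data.Sum using (_⊎_)
open import Relation.Binary.PropositionalEquality using (_≡_)
open import Relation.Nullary using (¬_)

record Graph : Set where
  field
    n      : ℕ
    adj    : Fin n → Fin n → Bool
    sym    : ∀ u v → adj u v ≡ adj v u
    irrefl : ∀ v → ¬ (adj v v ≡ true)
    nonempty : 1 ≤ n

open Graph public

V : Graph → Set
V G = Fin (n G)

Adj : (G : Graph) → V G → V G → Set
Adj G u v = adj G u v ≡ true

-- A walk from a to b: a non-empty list of vertices, consecutive ones adjacent,
-- starting at a and ending at b.  Its length (number of edges) is length xs - 1.
IsWalk : (G : Graph) → V G → V G → List (V G) → Set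
IsWalk G a b xs = Linked (Adj G) xs × head xs ≡ just a × last xs ≡ just b

IsPath : (G : Graph) → V G → V G → List (V G) → Set
IsPath G a b xs = IsWalk G a b xs × Unique xs

Connected : Graph → Set
Connected G = ∀ (u v : V G) → ∃ λ xs → IsWalk G u v xs

IsDist : (G : Graph) → V G → V G → ℕ → Set
IsDist G u v k =
  (∃ λ xs → IsWalk G u v xs × length xs ≡ suc k) ×
  (∀ ys → IsWalk G u v ys → suc k ≤ length ys)

EqDist : (G : Graph) → V G → V G → V G → Set
EqDist G x u w = ∃ λ k → IsDist G x u k × IsDist G x w k

data Consec {A : Set} : List A → A → A → Set where
  here  : ∀ {u v xs} → Consec (u ∷ v ∷ xs) u v
  there : ∀ {x xs u v} → Consec xs u v → Consec (x ∷ xs) u v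

EdgeOf : {A : Set} → List A → A → A → Set
EdgeOf xs u v = Consec xs u v ⊎ Consec xs v u

close : {A : Set} → List A → List A
close []       = []
close (x ∷ xs) = x ∷ (xs ++ [ x ])

IsCycle : (G : Graph) → List (V G) → Set
IsCycle G cs = 3 ≤ length cs × Unique cs × Linked (Adj G) (close cs)

CycleEdge : {A : Set} → List A → A → A → Set
CycleEdge cs u v = EdgeOf (close cs) u v

-- Two cycle representations denote the same cycle iff they have the same edge set.
SameCycle : {A : Set} → List A → List A → Set
SameCycle cs ds = ∀ u v → (CycleEdge cs u v → CycleEdge ds u v) × (CycleEdge ds u v → CycleEdge cs u v)

Cactus : Graph → Set
Cactus G = ∀ cs ds → IsCycle G cs → IsCycle G ds → ∀ u v →
           CycleEdge cs u v → CycleEdge ds u v → SameCycle cs ds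

Odd : ℕ → Set
Odd m = ∃ λ k → m ≡ suc (2 * k)

OddCactus : Graph → Set
OddCactus G = Cactus G × (∀ cs → IsCycle G cs → Odd (length cs))

Shortest : (G : Graph) → V G → V G → List (V G) → Set
Shortest G a b P = IsPath G a b P × (∀ Q → IsPath G a b Q → length P ≤ length Q)

module Submission where

-- If P is a shortest a,b
-- path, pq is an edge of P and x is a vertex of P, then d(x,p) ≠ d(x,q).
-- Indeed, if x precedes the edge pq on P, the part of P from x to p shows
-- d(x,p) ≤ ℓ (its length), while the part of P from x onwards is a shortest walk,
-- so it cannot be improved by going from x to q directly: d(x,q) ≥ ℓ + 1.
--
-- This
-- proves the key fact when x precedes the edge pq on P; the remaining case is
-- reduced to it by reversing P.  The theorem lemma4 is then immediate.

open import Defs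
open import Data.Empty using (⊥)
open import Data.Fin.Properties using (_≟_)
open import Data.List using (List; []; _∷_; _++_; [_]; _∷ʳ_; length; reverse)
open import Data.List.Membership.Propositional using (_∈_)
open import Data.List.Membership.Propositional.Properties using (∈-∃++)
open import Data.List.Properties
  using (length-++; length-reverse; unfold-reverse; reverse-++; ++-assoc)
import Data.List.Relation.Unary.All as All
open import Data.List.Relation.Unary.All.Properties using (¬Any⇒All¬)
open import Data.List.Relation.Unary.AllPairs using ([]; _∷_)
open import Data.List.Relation.Unary.Linked using ([-]; _∷_)
open import Data.List.Relation.Unary.Unique.Propositional using (Unique)
open import Data.Nat using (suc; _+_; _≤_; s≤s)
open import Data.Nat.Properties
  using (≤-refl; ≤-trans; m≤n+m; n≤1+n; +-suc; +-comm; +-cancelʳ-≤; +-cancelˡ-≤; <-irrefl)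
open import Data.Product using (∃; _×_; _,_; proj₁; proj₂)
open import Data.Sum using (_⊎_; inj₁; inj₂)
open import Relation.Binary.PropositionalEquality
  using (_≡_; refl; trans; cong; subst; subst₂; module ≡-Reasoning) renaming (sym to ≡-sym)
open import Relation.Nullary using (¬_; yes; no)

module _ {A : Set} where

  consec-split : ∀ {u v : A} xs → Consec xs u v → ∃ λ X → ∃ λ R → xs ≡ X ++ u ∷ v ∷ R
  consec-split _        here      = [] , _ , refl
  consec-split (y ∷ xs) (there c) with consec-split xs c
  ... | X , R , refl = y ∷ X , R , refl

  consec-cut : ∀ {u v : A} L y T → Consec (L ++ y ∷ T) u v →
               Consec (L ++ [ y ]) u v ⊎ Consec (y ∷ T) u v
  consec-cut []            y T c         = inj₂ c
  consec-cut (l ∷ [])      y T here      = inj₁ here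
  consec-cut (l ∷ m ∷ L)   y T here      = inj₁ here
  consec-cut (l ∷ L)       y T (there c) with consec-cut L y T c
  ... | inj₁ c′ = inj₁ (there c′)
  ... | inj₂ c′ = inj₂ c′

  consec-++ : ∀ {u v : A} xs ys → Consec xs u v → Consec (xs ++ ys) u v
  consec-++ _        ys here      = here
  consec-++ (x ∷ xs) ys (there c) = there (consec-++ xs ys c)

  consec-last : ∀ (u v : A) xs → Consec (xs ∷ʳ u ∷ʳ v) u v
  consec-last u v []       = here
  consec-last u v (x ∷ xs) = there (consec-last u v xs)

  consec-reverse : ∀ {u v : A} xs → Consec xs u v → Consec (reverse xs) v u
  consec-reverse {u} {v} (u ∷ v ∷ xs) here =
    subst (λ zs → Consec zs v u) (≡-sym reversed) (consec-last v u (reverse xs))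
    where
      open ≡-Reasoning
      reversed : reverse (u ∷ v ∷ xs) ≡ reverse xs ∷ʳ v ∷ʳ u
      reversed = begin
        reverse (u ∷ v ∷ xs)     ≡⟨ unfold-reverse u (v ∷ xs) ⟩
        reverse (v ∷ xs) ∷ʳ u    ≡⟨ cong (_∷ʳ u) (unfold-reverse v xs) ⟩
        reverse xs ∷ʳ v ∷ʳ u     ∎
  consec-reverse (x ∷ xs) (there c) =
    subst (λ zs → Consec zs _ _) (≡-sym (unfold-reverse x xs))
          (consec-++ (reverse xs) [ x ] (consec-reverse xs c))

  reverse-around : ∀ L (y : A) T → reverse (L ++ y ∷ T) ≡ reverse T ++ y ∷ reverse L
  reverse-around L y T = begin
    reverse (L ++ y ∷ T)          ≡⟨ reverse-++ L (y ∷ T) ⟩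
    reverse (y ∷ T) ++ reverse L  ≡⟨ cong (_++ reverse L) (unfold-reverse y T) ⟩
    (reverse T ∷ʳ y) ++ reverse L ≡⟨ ++-assoc (reverse T) [ y ] (reverse L) ⟩
    reverse T ++ y ∷ reverse L    ∎
    where open ≡-Reasoning

  unique-suffix : ∀ L (B : List A) → Unique (L ++ B) → Unique B
  unique-suffix []      B u       = u
  unique-suffix (x ∷ L) B (_ ∷ u) = unique-suffix L B u

  length-suffix : ∀ L (B : List A) → length B ≤ length (L ++ B)
  length-suffix L B = subst (length B ≤_) (≡-sym (length-++ L)) (m≤n+m (length B) (length L))

module Walks (G : Graph) where

  open import Data.List.Membership.DecPropositional (_≟_ {n G}) using (_∈?_)

  -- Wk s t xs: the vertex list xs is a walk from s to t.  Equivalent to IsWalk,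
  -- but with the endpoints built into the induction.
  data Wk : V G → V G → List (V G) → Set where
    one  : ∀ {s} → Wk s s [ s ]
    cons : ∀ {s y t xs} → Adj G s y → Wk y t xs → Wk s t (s ∷ xs)

  fromIsWalk : ∀ {a b} xs → IsWalk G a b xs → Wk a b xs
  fromIsWalk []           (_     , ()   , _)
  fromIsWalk (x ∷ [])     (_     , refl , refl) = one
  fromIsWalk (x ∷ y ∷ zs) (r ∷ l , refl , e)    = cons r (fromIsWalk (y ∷ zs) (l , refl , e))

  prepend : ∀ {s y b} xs → Adj G s y → IsWalk G y b xs → IsWalk G s b (s ∷ xs)
  prepend []       r (_ , () , _)
  prepend (z ∷ zs) r (l , refl , e) = r ∷ l , refl , e

  toIsWalk : ∀ {a b xs} → Wk a b xs → IsWalk G a b xs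
  toIsWalk one                  = [-] , refl , refl
  toIsWalk (cons {xs = xs} r w) = prepend xs r (toIsWalk w)

  start : ∀ {a b s T} → Wk a b (s ∷ T) → a ≡ s
  start one        = refl
  start (cons _ _) = refl

  suffix : ∀ {a b s} L T → Wk a b (L ++ s ∷ T) → Wk s b (s ∷ T)
  suffix []          T w with start w
  ... | refl = w
  suffix (x ∷ [])    T (cons r w) = suffix [] T w
  suffix (x ∷ y ∷ L) T (cons r w) = suffix (y ∷ L) T w

  drop-start : ∀ {p q b R} → Wk p b (p ∷ q ∷ R) → Wk q b (q ∷ R)
  drop-start w = suffix [ _ ] _ w

  split : ∀ {s b m} X Y → Wk s b (X ++ m ∷ Y) → Wk s m (X ++ [ m ]) × Wk m b (m ∷ Y)
  split []          Y w with start w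
  ... | refl = one , w
  split (x ∷ [])    Y (cons r w) with start w
  ... | refl = cons r one , w
  split (x ∷ z ∷ X) Y (cons r w) with split (z ∷ X) Y w
  ... | p , q = cons r p , q

  concat : ∀ {s m b X} Y → Wk s m X → Wk m b (m ∷ Y) → Wk s b (X ++ Y)
  concat Y one        w′ = w′
  concat Y (cons r w) w′ = cons r (concat Y w w′)

  replace : ∀ {a b s} L T W → Wk a b (L ++ s ∷ T) → Wk s b W → Wk a b (L ++ W)
  replace []          T W w v with start w
  ... | refl = v
  replace (x ∷ [])    T W (cons r w) v with start w
  ... | refl = cons r v
  replace (x ∷ y ∷ L) T W (cons r w) v = cons r (replace (y ∷ L) T W w v)

  snoc : ∀ {s t u xs} → Wk s t xs → Adj G t u → Wk s u (xs ∷ʳ u)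
  snoc one         r = cons r one
  snoc (cons r′ w) r = cons r′ (snoc w r)

  rev : ∀ {s t xs} → Wk s t xs → Wk t s (reverse xs)
  rev one = one
  rev (cons {s} {y} {xs = xs} r w) =
    subst (Wk _ _) (≡-sym (unfold-reverse s xs)) (snoc (rev w) (trans (Graph.sym G y s) r))

  -- Every walk s..t contains a path s..t that is no longer: cut out the closed
  -- subwalk between two visits of a repeated vertex.
  shorten : ∀ {s t xs} → Wk s t xs → ∃ λ ys → Wk s t ys × Unique ys × length ys ≤ length xs
  shorten one = _ , one , (All.[] ∷ []) , ≤-refl
  shorten (cons {s} r w) with shorten w
  ... | ys , wy , uy , le with s ∈? ys
  ... | no s∉ys = s ∷ ys , cons r wy , (¬Any⇒All¬ ys s∉ys ∷ uy) , s≤s le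
  ... | yes s∈ys with ∈-∃++ s∈ys
  ... | A , B , refl = s ∷ B , suffix A B wy , unique-suffix A (s ∷ B) uy ,
                       ≤-trans (length-suffix A (s ∷ B)) (≤-trans le (n≤1+n _))

  ShortestWalk : V G → V G → List (V G) → Set
  ShortestWalk a b P = Wk a b P × (∀ Z → Wk a b Z → length P ≤ length Z)

  -- A shortest path is a shortest walk, since every walk shortens to a path.
  shortest-path⇒shortest-walk : ∀ {a b P} → Shortest G a b P → ShortestWalk a b P
  shortest-path⇒shortest-walk {P = P} ((walk , _) , minimal) = fromIsWalk P walk , no-shorter-walk
    where
      no-shorter-walk : ∀ Z → Wk _ _ Z → length P ≤ length Z
      no-shorter-walk Z wZ with shorten wZ
      ... | Y , wY , uY , Y≤Z = ≤-trans (minimal Y (toIsWalk wY , uY)) Y≤Z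

  reverse-shortest : ∀ {a b P} → ShortestWalk a b P → ShortestWalk b a (reverse P)
  reverse-shortest {P = P} (w , minimal) = rev w , λ Z wZ →
    subst₂ _≤_ (≡-sym (length-reverse P)) (length-reverse Z) (minimal (reverse Z) (rev wZ))

  -- Every suffix of a shortest walk is a shortest walk: a shorter walk from s to
  -- b could replace it.
  suffix-shortest : ∀ {a b s} L T → ShortestWalk a b (L ++ s ∷ T) → ShortestWalk s b (s ∷ T)
  suffix-shortest L T (w , minimal) = suffix L T w , λ W wW →
    +-cancelˡ-≤ (length L) _ _
      (subst₂ _≤_ (length-++ L) (length-++ L) (minimal (L ++ W) (replace L T W w wW)))

  -- On a shortest walk, a vertex x followed (not necessarily directly) by the
  -- edge pq is nearer to p than to q: the walk itself reaches p from x in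
  -- length X steps, so d(x,p) ≤ length X, whereas going from x to q in d(x,q)
  -- steps and then along the walk shows length X + 1 ≤ d(x,q).
  equidistant-after : ∀ {a b x p q k} L T → ShortestWalk a b (L ++ x ∷ T) → Consec (x ∷ T) p q →
                      IsDist G x p k → IsDist G x q k → ⊥
  equidistant-after {b = b} {x} {p} {q} {k} L T sw c (_ , p-minimal) ((W , walk-W , |W|) , _)
    with consec-split (x ∷ T) c
  ... | X , R , x∷T≡ = contradiction
    where
      from-x : ShortestWalk x b (X ++ p ∷ q ∷ R)
      from-x = subst (ShortestWalk x b) x∷T≡ (suffix-shortest L T sw)

      x-to-p : Wk x p (X ++ [ p ])
      x-to-p = proj₁ (split X (q ∷ R) (proj₁ from-x))

      q-to-b : Wk q b (q ∷ R)
      q-to-b = drop-start (proj₂ (split X (q ∷ R) (proj₁ from-x)))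

      dist-p≤ : suc k ≤ length X + 1
      dist-p≤ = subst (suc k ≤_) (length-++ X) (p-minimal _ (toIsWalk x-to-p))

      ≤dist-q : length X + suc (suc (length R)) ≤ suc k + length R
      ≤dist-q = subst₂ _≤_ (length-++ X) (trans (length-++ W) (cong (_+ length R) |W|))
                  (proj₂ from-x (W ++ R) (concat R (fromIsWalk W walk-W) q-to-b))

      -- ≤dist-q says length X + 1 ≤ k, dist-p≤ says k ≤ length X.
      contradiction : ⊥
      contradiction = <-irrefl refl (≤-trans ≤k (subst (suc k ≤_) (+-comm (length X) 1) dist-p≤))
        where
          ≤k : suc (suc (length X)) ≤ suc k
          ≤k = +-cancelʳ-≤ (length R) _ _
                 (subst (_≤ suc k + length R)
                    (trans (+-suc (length X) (suc (length R))) (cong suc (+-suc (length X) (length R))))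
                    ≤dist-q)

  -- The key fact: no vertex of a shortest walk is equidistant from the two ends
  -- of an edge of that walk.  If x comes after the edge, reverse the walk.
  equidistant-edge : ∀ {a b x p q k} P → ShortestWalk a b P → Consec P p q → x ∈ P →
                     IsDist G x p k → IsDist G x q k → ⊥
  equidistant-edge {a} {b} {x} {p} {q} P sw c x∈P dp dq with ∈-∃++ x∈P
  ... | L , T , refl with consec-cut L _ T c
  ... | inj₂ c′ = equidistant-after L T sw c′ dp dq
  ... | inj₁ c′ = equidistant-after (reverse T) (reverse L) reversed-sw reversed-c dq dp
    where
      reversed-sw : ShortestWalk b a (reverse T ++ x ∷ reverse L)
      reversed-sw = subst (ShortestWalk _ _) (reverse-around L x T) (reverse-shortest sw)
      reversed-c : Consec (x ∷ reverse L) q p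
      reversed-c = subst (λ zs → Consec zs q p) (reverse-++ L [ x ]) (consec-reverse (L ++ [ x ]) c′)

open Walks using (equidistant-edge; shortest-path⇒shortest-walk)

lemma4 : (G : Graph) → Connected G → OddCactus G →
         (a b : V G) (P : List (V G)) → IsPath G a b P →
         (C : List (V G)) → IsCycle G C →
         (u w : V G) → CycleEdge C u w → EdgeOf P u w →
         (x : V G) → x ∈ C → EqDist G x u w → x ∈ P →
         ¬ Shortest G a b P
lemma4 G _ _ a b P _ C _ u w _ uw∈P x _ (k , du , dw) x∈P shortest with uw∈P
... | inj₁ c = equidistant-edge G P (shortest-path⇒shortest-walk G shortest) c x∈P du dw
... | inj₂ c = equidistant-edge G P (shortest-path⇒shortest-walk G shortest) c x∈P dw du
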